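{- Let $M\ge m\ge2$ and $N\ge n\ge2$ be integers and $\sigma,\vartheta\in\mathbb{R}$ with $\sigma+M-m\ge0$ and $\vartheta+N-n\ge0$. Assume that at least one of the following holds: (i) $\sigma\ge0$; (ii) $\vartheta\ge0$; (iii) $\sigma+\vartheta\ge-1$. Then $$\Sigma(M,N,\sigma,\vartheta)\ge\Sigma(m,n,\sigma+M-m,\vartheta+N-n).$$
   Context: For integers $m,n$ and reals $\sigma,\vartheta$, $\Sigma(m,n,\sigma,\vartheta)=(m-1+\sigma)(n-1+\vartheta)-\sigma\vartheta$. -}

module Defs where

open import Level using (Level; suc; _⊔_)
open import Data.Nat using (ℕ)
open import Data.Sum using (_⊎_)
open import Relation.Nullary using (¬_)
open import Relation.Binary.Core using (Rel)
open import Relation.Binary.Structures using (IsTotalOrder)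
open import Algebra.Bundles using (CommutativeRing)
import Algebra.Properties.Semiring.Mult as Mult

-- An ordered field (the standard library has no reals; ℝ is an instance).
record OrderedField c ℓ₁ ℓ₂ : Set (suc (c ⊔ ℓ₁ ⊔ ℓ₂)) where
  field
    commutativeRing : CommutativeRing c ℓ₁
  open CommutativeRing commutativeRing public
  field
    _≤_         : Rel Carrier ℓ₂
    isTotalOrder : IsTotalOrder _≈_ _≤_
    +-mono-≤    : ∀ {x y} z → x ≤ y → (x + z) ≤ (y + z)
    *-nonneg    : ∀ {x y} → 0# ≤ x → 0# ≤ y → 0# ≤ (x * y)
    0≉1         : ¬ (0# ≈ 1#)
    _⁻¹         : Carrier → Carrier
    ⁻¹-inverse  : ∀ x → ¬ (x ≈ 0#) → (x * (x ⁻¹)) ≈ 1#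

  infix 4 _≥_
  _≥_ : Rel Carrier ℓ₂
  x ≥ y = y ≤ x

  ι : ℕ → Carrier
  ι n = n × 1#
    where open Mult semiring using (_×_)

  Σ′ : ℕ → ℕ → Carrier → Carrier → Carrier
  Σ′ m n σ ϑ = ((ι m - 1# + σ) * (ι n - 1# + ϑ)) - (σ * ϑ)

{-# OPTIONS --safe #-}
module Submission where

-- With σ′ = σ + (M − m) and ϑ′ = ϑ + (N − n) the first factors of the two
-- values of Σ coincide, m − 1 + σ′ = M − 1 + σ and n − 1 + ϑ′ = N − 1 + ϑ, so
-- the claim is σϑ ≤ σ′ϑ′ = (σ + a)(ϑ + b) with naturals a = M − m, b = N − n.
-- If σ ≥ 0 or ϑ ≥ 0 this is plain monotonicity. If both are negative then
-- σ′, ϑ′ ≥ 0 forces a = 1 + d and b = 1 + e, and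
--   (σ + a)(ϑ + b) = σϑ + (σ + ϑ + 1) + d(ϑ + 1) + e(σ + 1) + de,
-- where every added term is nonnegative once σ + ϑ ≥ −1.

open import Defs
open import Data.Nat using (ℕ; zero; suc; _∸_) renaming (_≤_ to _≤ℕ_; _+_ to _+ℕ_)
open import Data.Nat.Properties using (m+[n∸m]≡n)
open import Data.Sum using (_⊎_; inj₁; inj₂)
open import Relation.Binary.Bundles using (Poset)
open import Relation.Binary.Structures using (IsTotalOrder; IsPartialOrder)
open import Relation.Binary.PropositionalEquality using (cong)
import Algebra.Properties.AbelianGroup as AbelianGroupProperties
import Algebra.Properties.Semiring.Mult as SemiringMult
import Algebra.Solver.Ring.NaturalCoefficients.Default as SemiringSolver
import Relation.Binary.Reasoning.PartialOrder as PosetReasoning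

module OrderedFieldProperties {c ℓ₁ ℓ₂} (F : OrderedField c ℓ₁ ℓ₂) where
  open OrderedField F hiding (zero)
  open IsTotalOrder isTotalOrder using (total; isPartialOrder)
  open IsPartialOrder isPartialOrder
    using (≤-respʳ-≈; ≤-respˡ-≈) renaming (reflexive to ≤-reflexive; trans to ≤-trans)
  open AbelianGroupProperties +-abelianGroup using (xyx⁻¹≈y; ε⁻¹≈ε; ⁻¹-involutive)
  open import Algebra.Properties.Ring ring using (-1*x≈-x)
  open SemiringSolver commutativeSemiring using (solve; _:=_; _:+_)

  poset : Poset c ℓ₁ ℓ₂
  poset = record { isPartialOrder = isPartialOrder }

  open PosetReasoning poset

  +-monoʳ-≤ : ∀ {x y} z → x ≤ y → (z + x) ≤ (z + y)
  +-monoʳ-≤ {x} {y} z x≤y = begin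
    z + x  ≈⟨ +-comm z x ⟩
    x + z  ≤⟨ +-mono-≤ z x≤y ⟩
    y + z  ≈⟨ +-comm y z ⟩
    z + y  ∎

  x≤x+y : ∀ {x y} → 0# ≤ y → x ≤ (x + y)
  x≤x+y {x} {y} 0≤y = begin
    x       ≈⟨ +-identityʳ x ⟨
    x + 0#  ≤⟨ +-monoʳ-≤ x 0≤y ⟩
    x + y   ∎

  x≤0⇒x+y≤y : ∀ {x} y → x ≤ 0# → (x + y) ≤ y
  x≤0⇒x+y≤y {x} y x≤0 = begin
    x + y   ≤⟨ +-mono-≤ y x≤0 ⟩
    0# + y  ≈⟨ +-identityˡ y ⟩
    y       ∎

  +-nonneg : ∀ {x y} → 0# ≤ x → 0# ≤ y → 0# ≤ (x + y)
  +-nonneg 0≤x 0≤y = ≤-trans 0≤x (x≤x+y 0≤y)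

  -‿antitone : ∀ {x y} → x ≤ y → (- y) ≤ (- x)
  -‿antitone {x} {y} x≤y = begin
    - y              ≈⟨ xyx⁻¹≈y x (- y) ⟨
    (x - y) - x      ≤⟨ +-mono-≤ (- x) (+-mono-≤ (- y) x≤y) ⟩
    (y - y) - x      ≈⟨ +-congʳ (-‿inverseʳ y) ⟩
    0# - x           ≈⟨ +-identityˡ (- x) ⟩
    - x              ∎

  0≤1 : 0# ≤ 1#
  0≤1 with total 0# 1#
  ... | inj₁ 0≤1 = 0≤1
  ... | inj₂ 1≤0 = ≤-respʳ-≈ (-1*-1≈1) (*-nonneg 0≤-1 0≤-1)
    where
    0≤-1 : 0# ≤ (- 1#)
    0≤-1 = ≤-respˡ-≈ ε⁻¹≈ε (-‿antitone 1≤0)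
    -1*-1≈1 : (- 1#) * (- 1#) ≈ 1#
    -1*-1≈1 = trans (-1*x≈-x (- 1#)) (⁻¹-involutive 1#)

  ι-nonneg : ∀ k → 0# ≤ ι k
  ι-nonneg zero    = ≤-reflexive refl
  ι-nonneg (suc k) = +-nonneg 0≤1 (ι-nonneg k)

  ι-∸ : ∀ {m M} → m ≤ℕ M → (ι M - ι m) ≈ ι (M ∸ m)
  ι-∸ {m} {M} m≤M = begin-equality
    ι M - ι m                   ≈⟨ +-congʳ (reflexive (cong ι (m+[n∸m]≡n m≤M))) ⟨
    ι (m +ℕ (M ∸ m)) - ι m      ≈⟨ +-congʳ (×-homo-+ 1# m (M ∸ m)) ⟩
    (ι m + ι (M ∸ m)) - ι m     ≈⟨ xyx⁻¹≈y (ι m) (ι (M ∸ m)) ⟩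
    ι (M ∸ m)                   ∎
    where open SemiringMult semiring using (×-homo-+)

  y-1+[s+[x-y]]≈x-1+s : ∀ x y s → ((y - 1#) + (s + (x - y))) ≈ ((x - 1#) + s)
  y-1+[s+[x-y]]≈x-1+s x y s = begin-equality
    (y - 1#) + (s + (x - y))   ≈⟨ solve 5 (λ x y s u v → (y :+ u) :+ (s :+ (x :+ v)) := (y :+ ((x :+ u) :+ s)) :+ v)
                                        refl x y s (- 1#) (- y) ⟩
    (y + ((x - 1#) + s)) - y   ≈⟨ xyx⁻¹≈y y ((x - 1#) + s) ⟩
    (x - 1#) + s               ∎

module ShiftedProduct {c ℓ₁ ℓ₂} (F : OrderedField c ℓ₁ ℓ₂) where
  open OrderedField F hiding (zero)
  open OrderedFieldProperties F
  open IsTotalOrder isTotalOrder using (total; isPartialOrder)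
  open IsPartialOrder isPartialOrder using (≤-respʳ-≈)
  open SemiringSolver commutativeSemiring using (solve; _:=_; _:+_; _:*_; con)
  open PosetReasoning poset

  *-shift-monoˡ : ∀ {σ ϑ a b} → 0# ≤ σ → 0# ≤ a → 0# ≤ b → 0# ≤ (ϑ + b) →
                  (σ * ϑ) ≤ ((σ + a) * (ϑ + b))
  *-shift-monoˡ {σ} {ϑ} {a} {b} 0≤σ 0≤a 0≤b 0≤ϑ+b = begin
    σ * ϑ                           ≤⟨ x≤x+y (+-nonneg (*-nonneg 0≤σ 0≤b) (*-nonneg 0≤a 0≤ϑ+b)) ⟩
    σ * ϑ + (σ * b + a * (ϑ + b))   ≈⟨ solve 4 (λ s t x y → s :* t :+ (s :* y :+ x :* (t :+ y)) := (s :+ x) :* (t :+ y))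
                                             refl σ ϑ a b ⟩
    (σ + a) * (ϑ + b)               ∎

  *-shift-monoʳ : ∀ {σ ϑ a b} → 0# ≤ ϑ → 0# ≤ a → 0# ≤ b → 0# ≤ (σ + a) →
                  (σ * ϑ) ≤ ((σ + a) * (ϑ + b))
  *-shift-monoʳ {σ} {ϑ} {a} {b} 0≤ϑ 0≤a 0≤b 0≤σ+a = begin
    σ * ϑ               ≈⟨ *-comm σ ϑ ⟩
    ϑ * σ               ≤⟨ *-shift-monoˡ 0≤ϑ 0≤b 0≤a 0≤σ+a ⟩
    (ϑ + b) * (σ + a)   ≈⟨ *-comm (ϑ + b) (σ + a) ⟩
    (σ + a) * (ϑ + b)   ∎

  *-shift-mono-nonpos : ∀ {σ ϑ d e} → σ ≤ 0# → ϑ ≤ 0# → (- 1#) ≤ (σ + ϑ) → 0# ≤ d → 0# ≤ e →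
                        (σ * ϑ) ≤ ((σ + (1# + d)) * (ϑ + (1# + e)))
  *-shift-mono-nonpos {σ} {ϑ} {d} {e} σ≤0 ϑ≤0 -1≤σ+ϑ 0≤d 0≤e = begin
    σ * ϑ
      ≤⟨ x≤x+y (+-nonneg (+-nonneg (+-nonneg 0≤σ+ϑ+1 (*-nonneg 0≤d 0≤ϑ+1)) (*-nonneg 0≤e 0≤σ+1))
                         (*-nonneg 0≤d 0≤e)) ⟩
    σ * ϑ + ((((σ + ϑ) + 1#) + d * (ϑ + 1#)) + e * (σ + 1#) + d * e)
      ≈⟨ solve 4 (λ s t x y → s :* t :+ ((((s :+ t) :+ con 1) :+ x :* (t :+ con 1)) :+ y :* (s :+ con 1) :+ x :* y)
                            := (s :+ (con 1 :+ x)) :* (t :+ (con 1 :+ y)))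
                 refl σ ϑ d e ⟩
    (σ + (1# + d)) * (ϑ + (1# + e))
      ∎
    where
    0≤σ+ϑ+1 : 0# ≤ ((σ + ϑ) + 1#)
    0≤σ+ϑ+1 = begin
      0#               ≈⟨ -‿inverseˡ 1# ⟨
      - 1# + 1#        ≤⟨ +-mono-≤ 1# -1≤σ+ϑ ⟩
      (σ + ϑ) + 1#     ∎
    0≤ϑ+1 : 0# ≤ (ϑ + 1#)
    0≤ϑ+1 = begin
      0#               ≤⟨ 0≤σ+ϑ+1 ⟩
      (σ + ϑ) + 1#     ≈⟨ +-assoc σ ϑ 1# ⟩
      σ + (ϑ + 1#)     ≤⟨ x≤0⇒x+y≤y (ϑ + 1#) σ≤0 ⟩
      ϑ + 1#           ∎
    0≤σ+1 : 0# ≤ (σ + 1#)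
    0≤σ+1 = begin
      0#               ≤⟨ 0≤σ+ϑ+1 ⟩
      (σ + ϑ) + 1#     ≈⟨ solve 2 (λ s t → (s :+ t) :+ con 1 := t :+ (s :+ con 1)) refl σ ϑ ⟩
      ϑ + (σ + 1#)     ≤⟨ x≤0⇒x+y≤y (σ + 1#) ϑ≤0 ⟩
      σ + 1#           ∎

  *-shift-mono-ι : ∀ {σ ϑ} d e → 0# ≤ (σ + ι d) → 0# ≤ (ϑ + ι e) →
                   (σ ≥ 0#) ⊎ ((ϑ ≥ 0#) ⊎ ((σ + ϑ) ≥ - 1#)) →
                   (σ * ϑ) ≤ ((σ + ι d) * (ϑ + ι e))
  *-shift-mono-ι d e 0≤σ+d 0≤ϑ+e (inj₁ 0≤σ) =
    *-shift-monoˡ 0≤σ (ι-nonneg d) (ι-nonneg e) 0≤ϑ+e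
  *-shift-mono-ι d e 0≤σ+d 0≤ϑ+e (inj₂ (inj₁ 0≤ϑ)) =
    *-shift-monoʳ 0≤ϑ (ι-nonneg d) (ι-nonneg e) 0≤σ+d
  *-shift-mono-ι {σ} {ϑ} d e 0≤σ+d 0≤ϑ+e (inj₂ (inj₂ -1≤σ+ϑ)) with total 0# σ | total 0# ϑ
  ... | inj₁ 0≤σ | _        = *-shift-mono-ι d e 0≤σ+d 0≤ϑ+e (inj₁ 0≤σ)
  ... | inj₂ _   | inj₁ 0≤ϑ = *-shift-mono-ι d e 0≤σ+d 0≤ϑ+e (inj₂ (inj₁ 0≤ϑ))
  ... | inj₂ σ≤0 | inj₂ ϑ≤0 = nonpos-case d e 0≤σ+d 0≤ϑ+e
    where
    nonpos-case : ∀ d e → 0# ≤ (σ + ι d) → 0# ≤ (ϑ + ι e) → (σ * ϑ) ≤ ((σ + ι d) * (ϑ + ι e))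
    nonpos-case zero e 0≤σ+0 0≤ϑ+e =
      *-shift-mono-ι zero e 0≤σ+0 0≤ϑ+e (inj₁ (≤-respʳ-≈ (+-identityʳ σ) 0≤σ+0))
    nonpos-case (suc d) zero 0≤σ+d 0≤ϑ+0 =
      *-shift-mono-ι (suc d) zero 0≤σ+d 0≤ϑ+0 (inj₂ (inj₁ (≤-respʳ-≈ (+-identityʳ ϑ) 0≤ϑ+0)))
    nonpos-case (suc d) (suc e) _ _ =
      *-shift-mono-nonpos σ≤0 ϑ≤0 -1≤σ+ϑ (ι-nonneg d) (ι-nonneg e)

  Σ′-shift-mono : ∀ m M n N {σ ϑ} →
                  (σ * ϑ) ≤ ((σ + (ι M - ι m)) * (ϑ + (ι N - ι n))) →
                  Σ′ m n (σ + (ι M - ι m)) (ϑ + (ι N - ι n)) ≤ Σ′ M N σ ϑ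
  Σ′-shift-mono m M n N {σ} {ϑ} σϑ≤σ′ϑ′ = begin
    ((ι m - 1# + σ′) * (ι n - 1# + ϑ′)) - σ′ * ϑ′
      ≈⟨ +-congʳ (*-cong (y-1+[s+[x-y]]≈x-1+s (ι M) (ι m) σ) (y-1+[s+[x-y]]≈x-1+s (ι N) (ι n) ϑ)) ⟩
    ((ι M - 1# + σ) * (ι N - 1# + ϑ)) - σ′ * ϑ′
      ≤⟨ +-monoʳ-≤ ((ι M - 1# + σ) * (ι N - 1# + ϑ)) (-‿antitone σϑ≤σ′ϑ′) ⟩
    ((ι M - 1# + σ) * (ι N - 1# + ϑ)) - σ * ϑ
      ∎
    where
    σ′ = σ + (ι M - ι m)
    ϑ′ = ϑ + (ι N - ι n)

lemma2p2 : ∀ {c ℓ₁ ℓ₂} (F : OrderedField c ℓ₁ ℓ₂) → let open OrderedField F in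
    (M m N n : ℕ) → 2 ≤ℕ m → m ≤ℕ M → 2 ≤ℕ n → n ≤ℕ N →
    (σ ϑ : Carrier) →
    (σ + (ι M - ι m)) ≥ 0# → (ϑ + (ι N - ι n)) ≥ 0# →
    (σ ≥ 0#) ⊎ ((ϑ ≥ 0#) ⊎ ((σ + ϑ) ≥ - 1#)) →
    Σ′ M N σ ϑ ≥ Σ′ m n (σ + (ι M - ι m)) (ϑ + (ι N - ι n))
lemma2p2 F M m N n _ m≤M _ n≤N σ ϑ 0≤σ′ 0≤ϑ′ cond =
  Σ′-shift-mono m M n N (≤-respʳ-≈ (*-cong (+-congˡ (sym ι-M∸m)) (+-congˡ (sym ι-N∸n)))
    (*-shift-mono-ι (M ∸ m) (N ∸ n) (≤-respʳ-≈ (+-congˡ ι-M∸m) 0≤σ′) (≤-respʳ-≈ (+-congˡ ι-N∸n) 0≤ϑ′) cond))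
  where
  open OrderedField F
  open OrderedFieldProperties F using (ι-∸)
  open ShiftedProduct F
  open IsPartialOrder (IsTotalOrder.isPartialOrder isTotalOrder) using (≤-respʳ-≈)
  ι-M∸m : (ι M - ι m) ≈ ι (M ∸ m)
  ι-M∸m = ι-∸ m≤M
  ι-N∸n : (ι N - ι n) ≈ ι (N ∸ n)
  ι-N∸n = ι-∸ n≤N
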